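{- For all natural numbers $x,y$, $$S_{7,0}(128y)-S_{7,0}(128x)=-7\bigl(S_{7,0}(2y)-S_{7,0}(2x)\bigr).$$
   Context: For an integer $n\ge 0$ with binary expansion $n=\sum_{k=0}^{v}a_k2^k$, $a_k\in\{0,1\}$, let $\sigma(n)=\sum_k a_k$ be its binary digit sum. For integers $m\ge 1$, $0\le l\le m-1$ and $x\in\mathbb{N}$, define $S_{m,l}(x)=\sum_{0\le n<x,\ n\equiv l \pmod m}(-1)^{\sigma(n)}$. The paper writes $S_{m,0}([a,b))=S_{m,0}(b)-S_{m,0}(a)$. -}

module Defs where

open import Data.Nat using (ℕ; zero; suc; _+_; _*_; _%_; _/_; _≡ᵇ_)
open import Data.Integer using (ℤ; +_; -_; _-_) renaming (_+_ to _+ℤ_)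
open import Data.Bool using (if_then_else_)

-- binary digit sum with fuel; fuel ≥ n suffices since n/2 < n for n ≥ 1
σ-fuel : ℕ → ℕ → ℕ
σ-fuel zero    n = 0
σ-fuel (suc f) n = n % 2 + σ-fuel f (n / 2)

σ : ℕ → ℕ
σ n = σ-fuel n n

sgn : ℕ → ℤ
sgn k = if (k % 2) ≡ᵇ 0 then + 1 else - (+ 1)

S : (m l x : ℕ) → .{{_ : Data.Nat.NonZero m}} → ℤ
S m l zero    = + 0
S m l (suc n) = S m l n +ℤ (if (n % m) ≡ᵇ l then sgn (σ n) else + 0)

{-# OPTIONS --safe #-}
module Submission where

-- Split n = 2^j q + r with r < 2^j.  Then σ(n) = σ(q) + σ(r), and since 2^7 ≡ 2^1 ≡ 2 (mod 7)
-- the residue of n mod 7 depends only on r and on 2q mod 7.  Hence, for j = 7 and j = 1 alike,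
-- the block [2^j q, 2^j (q + 1)) contributes (-1)^σ(q) times a sum over r < 2^j that depends
-- only on 2q mod 7, and for each of the seven residues the sum for j = 7 is -7 times the sum
-- for j = 1 (a finite computation).  Summing over the blocks, S₇,₀(128x) = -7 S₇,₀(2x).

open import Defs
open import Data.Nat using (ℕ; zero; suc; _+_; _*_; _^_; _%_; _/_; _≡ᵇ_; _<_; _≤_; z≤n; s≤s; NonZero)
open import Data.Nat.Properties
open import Data.Nat.DivMod
open import Data.Nat.Divisibility using (divides-refl)
open import Data.Nat.Tactic.RingSolver using (solve-∀)
open import Data.Bool using (true; false; if_then_else_)
open import Data.Integer using (ℤ; +_; -_; _-_) renaming (_*_ to _*ℤ_; _+_ to _+ℤ_)
import Data.Integer.Properties as ℤ
import Data.Integer.Tactic.RingSolver as ℤ-Solver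
open import Relation.Binary.PropositionalEquality
open ≡-Reasoning

σ-fuel-zero : ∀ f → σ-fuel f 0 ≡ 0
σ-fuel-zero zero    = refl
σ-fuel-zero (suc f) = σ-fuel-zero f

n≤1+f⇒n/2≤f : ∀ {n f} → n ≤ suc f → n / 2 ≤ f
n≤1+f⇒n/2≤f {zero}  _ = z≤n
n≤1+f⇒n/2≤f {suc n} p = ≤-pred (≤-trans (m/n<m (suc n) 2 (s≤s (s≤s z≤n))) p)

σ-fuel-irrelevant : ∀ {f g} n → n ≤ f → n ≤ g → σ-fuel f n ≡ σ-fuel g n
σ-fuel-irrelevant {zero}  {zero}  _ _   _   = refl
σ-fuel-irrelevant {zero}  {suc g} _ z≤n _   = sym (σ-fuel-zero g)
σ-fuel-irrelevant {suc f} {zero}  _ _   z≤n = σ-fuel-zero f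
σ-fuel-irrelevant {suc f} {suc g} n p   q   =
  cong (_+_ (n % 2)) (σ-fuel-irrelevant (n / 2) (n≤1+f⇒n/2≤f p) (n≤1+f⇒n/2≤f q))

σ-unfold : ∀ n → σ n ≡ n % 2 + σ (n / 2)
σ-unfold zero    = refl
σ-unfold (suc n) = cong (_+_ (suc n % 2)) (σ-fuel-irrelevant {n} (suc n / 2) (n≤1+f⇒n/2≤f ≤-refl) ≤-refl)

σ-bit+k*2 : ∀ {b} k → b < 2 → σ (b + k * 2) ≡ b + σ k
σ-bit+k*2 {b} k b<2 = begin
  σ (b + k * 2)                          ≡⟨ σ-unfold (b + k * 2) ⟩
  (b + k * 2) % 2 + σ ((b + k * 2) / 2)  ≡⟨ cong₂ (λ u v → u + σ v) low high ⟩
  b + σ k                                ∎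
  where
  low : (b + k * 2) % 2 ≡ b
  low = trans ([m+kn]%n≡m%n b k 2) (m<n⇒m%n≡m b<2)
  high : (b + k * 2) / 2 ≡ k
  high = begin
    (b + k * 2) / 2    ≡⟨ +-distrib-/-∣ʳ b (divides-refl k) ⟩
    b / 2 + k * 2 / 2  ≡⟨ cong₂ _+_ (m<n⇒m/n≡0 b<2) (m*n/n≡m k 2) ⟩
    k                  ∎

σ-+-2^* : ∀ j {r} x → r < 2 ^ j → σ (r + 2 ^ j * x) ≡ σ r + σ x
σ-+-2^* zero    x (s≤s z≤n) = cong σ (*-identityˡ x)
σ-+-2^* (suc j) {r} x r<2^1+j = begin
  σ (r + 2 ^ suc j * x)                ≡⟨ cong σ split ⟩
  σ (r % 2 + (r / 2 + 2 ^ j * x) * 2)  ≡⟨ σ-bit+k*2 (r / 2 + 2 ^ j * x) (m%n<n r 2) ⟩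
  r % 2 + σ (r / 2 + 2 ^ j * x)        ≡⟨ cong (_+_ (r % 2)) (σ-+-2^* j x r/2<2^j) ⟩
  r % 2 + (σ (r / 2) + σ x)            ≡⟨ +-assoc (r % 2) _ _ ⟨
  r % 2 + σ (r / 2) + σ x              ≡⟨ cong (_+ σ x) (σ-unfold r) ⟨
  σ r + σ x                            ∎
  where
  regroup : ∀ e q p y → e + q * 2 + 2 * p * y ≡ e + (q + p * y) * 2
  regroup = solve-∀
  split : r + 2 ^ suc j * x ≡ r % 2 + (r / 2 + 2 ^ j * x) * 2
  split = trans (cong (_+ 2 ^ suc j * x) (m≡m%n+[m/n]*n r 2)) (regroup (r % 2) (r / 2) (2 ^ j) x)
  r/2<2^j : r / 2 < 2 ^ j
  r/2<2^j = m<n*o⇒m/o<n (subst (r <_) (*-comm 2 (2 ^ j)) r<2^1+j)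

sgn-%2 : ∀ k → sgn k ≡ sgn (k % 2)
sgn-%2 k = cong (λ e → if e ≡ᵇ 0 then + 1 else - (+ 1)) (sym (m%n%n≡m%n k 2))

sgn-+ : ∀ a b → sgn (a + b) ≡ sgn a *ℤ sgn b
sgn-+ a b = begin
  sgn (a + b)                ≡⟨ sgn-%2 (a + b) ⟩
  sgn ((a + b) % 2)          ≡⟨ cong sgn (%-distribˡ-+ a b 2) ⟩
  sgn ((a % 2 + b % 2) % 2)  ≡⟨ sgn-%2 (a % 2 + b % 2) ⟨
  sgn (a % 2 + b % 2)        ≡⟨ bits (m%n<n a 2) (m%n<n b 2) ⟩
  sgn (a % 2) *ℤ sgn (b % 2) ≡⟨ cong₂ _*ℤ_ (sgn-%2 a) (sgn-%2 b) ⟨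
  sgn a *ℤ sgn b             ∎
  where
  bits : ∀ {u v} → u < 2 → v < 2 → sgn (u + v) ≡ sgn u *ℤ sgn v
  bits (s≤s z≤n)       (s≤s z≤n)       = refl
  bits (s≤s z≤n)       (s≤s (s≤s z≤n)) = refl
  bits (s≤s (s≤s z≤n)) (s≤s z≤n)       = refl
  bits (s≤s (s≤s z≤n)) (s≤s (s≤s z≤n)) = refl

sumTo : ℕ → (ℕ → ℤ) → ℤ
sumTo zero    f = + 0
sumTo (suc n) f = sumTo n f +ℤ f n

sumTo-cong : ∀ n {f g} → (∀ {r} → r < n → f r ≡ g r) → sumTo n f ≡ sumTo n g
sumTo-cong zero    f≗g = refl
sumTo-cong (suc n) f≗g = cong₂ _+ℤ_ (sumTo-cong n (λ r<n → f≗g (m<n⇒m<1+n r<n))) (f≗g ≤-refl)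

sumTo-*ˡ : ∀ n c f → sumTo n (λ r → c *ℤ f r) ≡ c *ℤ sumTo n f
sumTo-*ˡ zero    c f = sym (ℤ.*-zeroʳ c)
sumTo-*ˡ (suc n) c f =
  trans (cong (_+ℤ c *ℤ f n) (sumTo-*ˡ n c f)) (sym (ℤ.*-distribˡ-+ c (sumTo n f) (f n)))

term : (m l : ℕ) .{{_ : NonZero m}} → ℕ → ℤ
term m l n = if n % m ≡ᵇ l then sgn (σ n) else + 0

S-+ : ∀ m l .{{_ : NonZero m}} a k → S m l (a + k) ≡ S m l a +ℤ sumTo k (λ r → term m l (r + a))
S-+ m l a zero    = trans (cong (λ n → S m l n) (+-identityʳ a)) (sym (ℤ.+-identityʳ _))
S-+ m l a (suc k) rewrite +-suc a k =
  trans (cong₂ _+ℤ_ (S-+ m l a k) (cong (term m l) (+-comm a k))) (ℤ.+-assoc (S m l a) _ _)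

-- The summand of S at r + s with the sign (-1)^σ(s) of the high digits s factored out.
shiftedTerm : (m l : ℕ) .{{_ : NonZero m}} → ℕ → ℕ → ℤ
shiftedTerm m l s r = if (r + s) % m ≡ᵇ l then sgn (σ r) else + 0

shiftedTerm-%ˡ : ∀ m l .{{_ : NonZero m}} s r → shiftedTerm m l s r ≡ shiftedTerm m l (s % m) r
shiftedTerm-%ˡ m l s r = cong (λ e → if e ≡ᵇ l then sgn (σ r) else + 0) (begin
  (r + s) % m                      ≡⟨ cong (λ t → (r + t) % m) (m≡m%n+[m/n]*n s m) ⟩
  (r + (s % m + s / m * m)) % m    ≡⟨ cong (_% m) (+-assoc r (s % m) _) ⟨
  (r + s % m + s / m * m) % m      ≡⟨ [m+kn]%n≡m%n (r + s % m) (s / m) m ⟩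
  (r + s % m) % m                  ∎)

term-+-2^* : ∀ m l .{{_ : NonZero m}} j {r} x → r < 2 ^ j →
             term m l (r + 2 ^ j * x) ≡ sgn (σ x) *ℤ shiftedTerm m l (2 ^ j * x) r
term-+-2^* m l j {r} x r<2^j
  rewrite σ-+-2^* j x r<2^j | sgn-+ (σ r) (σ x)
  with (r + 2 ^ j * x) % m ≡ᵇ l
... | true  = ℤ.*-comm (sgn (σ r)) (sgn (σ x))
... | false = sym (ℤ.*-zeroʳ (sgn (σ x)))

blockSum : (m l : ℕ) .{{_ : NonZero m}} → ℕ → ℕ → ℤ
blockSum m l j s = sumTo (2 ^ j) (shiftedTerm m l s)

S-2^*-suc : ∀ m l .{{_ : NonZero m}} j x →
            S m l (2 ^ j * suc x) ≡ S m l (2 ^ j * x) +ℤ sgn (σ x) *ℤ blockSum m l j ((2 ^ j * x) % m)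
S-2^*-suc m l j x = begin
  S m l (2 ^ j * suc x)
    ≡⟨ cong (λ n → S m l n) (trans (*-suc (2 ^ j) x) (+-comm (2 ^ j) (2 ^ j * x))) ⟩
  S m l (a + 2 ^ j)
    ≡⟨ S-+ m l a (2 ^ j) ⟩
  S m l a +ℤ sumTo (2 ^ j) (λ r → term m l (r + a))
    ≡⟨ cong (S m l a +ℤ_) (sumTo-cong (2 ^ j) (term-+-2^* m l j x)) ⟩
  S m l a +ℤ sumTo (2 ^ j) (λ r → sgn (σ x) *ℤ shiftedTerm m l a r)
    ≡⟨ cong (S m l a +ℤ_) (sumTo-*ˡ (2 ^ j) (sgn (σ x)) (shiftedTerm m l a)) ⟩
  S m l a +ℤ sgn (σ x) *ℤ sumTo (2 ^ j) (shiftedTerm m l a)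
    ≡⟨ cong (λ t → S m l a +ℤ sgn (σ x) *ℤ t) (sumTo-cong (2 ^ j) (λ {r} _ → shiftedTerm-%ˡ m l a r)) ⟩
  S m l a +ℤ sgn (σ x) *ℤ blockSum m l j (a % m)
    ∎
  where a = 2 ^ j * x

128*x%7≡2*x%7 : ∀ x → 128 * x % 7 ≡ 2 * x % 7
128*x%7≡2*x%7 x = trans (cong (_% 7) (regroup x)) ([m+kn]%n≡m%n (2 * x) (18 * x) 7)
  where
  regroup : ∀ x → 128 * x ≡ 2 * x + 18 * x * 7
  regroup = solve-∀

blockSum-7-table : ∀ {s} → s < 7 → blockSum 7 0 7 s ≡ - (+ 7) *ℤ blockSum 7 0 1 s
blockSum-7-table {0} _ = refl
blockSum-7-table {1} _ = refl
blockSum-7-table {2} _ = refl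
blockSum-7-table {3} _ = refl
blockSum-7-table {4} _ = refl
blockSum-7-table {5} _ = refl
blockSum-7-table {6} _ = refl
blockSum-7-table {suc (suc (suc (suc (suc (suc (suc _))))))} (s≤s (s≤s (s≤s (s≤s (s≤s (s≤s (s≤s ())))))))

S₇,₀-128* : ∀ x → S 7 0 (128 * x) ≡ - (+ 7) *ℤ S 7 0 (2 * x)
S₇,₀-128* zero    = refl
S₇,₀-128* (suc x) = begin
  S 7 0 (128 * suc x)
    ≡⟨ S-2^*-suc 7 0 7 x ⟩
  S 7 0 (128 * x) +ℤ ε *ℤ blockSum 7 0 7 (128 * x % 7)
    ≡⟨ cong₂ (λ u v → u +ℤ ε *ℤ blockSum 7 0 7 v) (S₇,₀-128* x) (128*x%7≡2*x%7 x) ⟩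
  - (+ 7) *ℤ S 7 0 (2 * x) +ℤ ε *ℤ blockSum 7 0 7 s
    ≡⟨ cong (λ t → - (+ 7) *ℤ S 7 0 (2 * x) +ℤ ε *ℤ t) (blockSum-7-table (m%n<n (2 * x) 7)) ⟩
  - (+ 7) *ℤ S 7 0 (2 * x) +ℤ ε *ℤ (- (+ 7) *ℤ blockSum 7 0 1 s)
    ≡⟨ factor (S 7 0 (2 * x)) ε (blockSum 7 0 1 s) ⟩
  - (+ 7) *ℤ (S 7 0 (2 * x) +ℤ ε *ℤ blockSum 7 0 1 s)
    ≡⟨ cong (- (+ 7) *ℤ_) (S-2^*-suc 7 0 1 x) ⟨
  - (+ 7) *ℤ S 7 0 (2 * suc x)
    ∎
  where
  ε = sgn (σ x)
  s = 2 * x % 7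
  factor : ∀ A e B → - (+ 7) *ℤ A +ℤ e *ℤ (- (+ 7) *ℤ B) ≡ - (+ 7) *ℤ (A +ℤ e *ℤ B)
  factor = ℤ-Solver.solve-∀

mainTheorem2 : (x y : ℕ) →
    S 7 0 (128 * y) - S 7 0 (128 * x) ≡ - (+ 7) *ℤ (S 7 0 (2 * y) - S 7 0 (2 * x))
mainTheorem2 x y = begin
  S 7 0 (128 * y) - S 7 0 (128 * x)                    ≡⟨ cong₂ _-_ (S₇,₀-128* y) (S₇,₀-128* x) ⟩
  - (+ 7) *ℤ S 7 0 (2 * y) - - (+ 7) *ℤ S 7 0 (2 * x)  ≡⟨ factor (S 7 0 (2 * y)) (S 7 0 (2 * x)) ⟩
  - (+ 7) *ℤ (S 7 0 (2 * y) - S 7 0 (2 * x))           ∎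
  where
  factor : ∀ A B → - (+ 7) *ℤ A - - (+ 7) *ℤ B ≡ - (+ 7) *ℤ (A - B)
  factor = ℤ-Solver.solve-∀
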